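{- Let $k\ge 5$ be an integer, let $\mathbf{r}=(r_0,r_1,\ldots,r_{k-1})$ be an ordered $k$-tuple of positive integers, and let $h$ be an integer with $2\le h\le \sum_{j=0}^{k-1}r_j-2$. If $A$ is a set of $k$ integers, then $|h^{(\mathbf{r})}A|=L(\mathbf{r},h)$ if and only if $A$ is a $k$-term arithmetic progression.
   Context: Write $A=\{a_0,\ldots,a_{k-1}\}$ with $a_0<a_1<\cdots<a_{k-1}$. Define $$h^{(\mathbf{r})}A=\Big\{\sum_{i=0}^{k-1}s_ia_i:\ s_i\in\mathbb{Z},\ 0\le s_i\le r_i\ (0\le i\le k-1),\ \sum_{i=0}^{k-1}s_i=h\Big\}.$$ Empty sums are $0$. Let $I_{\mathbf{r}}(h)$ be the largest integer (with $0\le I_{\mathbf{r}}(h)\le k$) such that $\sum_{j=0}^{I_{\mathbf{r}}(h)-1}r_j\le h$, and $M_{\mathbf{r}}(h)$ the least integer (with $-1\le M_{\mathbf{r}}(h)\le k-1$) such that $\sum_{j=M_{\mathbf{r}}(h)+1}^{k-1}r_j\le h$. Put $\delta_{\mathbf{r}}(h)=h-\sum_{j=0}^{I_{\mathbf{r}}(h)-1}r_j$, $\theta_{\mathbf{r}}(h)=h-\sum_{j=M_{\mathbf{r}}(h)+1}^{k-1}r_j$, and $$L(\mathbf{r},h)=\sum_{j=M_{\mathbf{r}}(h)+1}^{k-1}j r_j-\sum_{j=0}^{I_{\mathbf{r}}(h)-1}j r_j+M_{\mathbf{r}}(h)\,\theta_{\mathbf{r}}(h)-I_{\mathbf{r}}(h)\,\delta_{\mathbf{r}}(h)+1.$$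 -}

module Defs where

open import Data.Nat as ℕ using (ℕ; zero; suc; _≤?_; _<?_)
open import Data.Fin using (Fin; zero; suc; fromℕ<; toℕ)
import Data.Fin
open import Data.Integer as ℤ using (ℤ; +_; _-_)
open import Data.List using (List; []; _∷_; map; concatMap; upTo; filter; deduplicate; length)
open import Data.Bool using (Bool; true; false; if_then_else_)
open import Data.Product using (Σ)
open import Relation.Nullary using (does; yes; no)
open import Relation.Binary.PropositionalEquality using (_≡_)

ΣFin : ∀ {n} → (Fin n → ℕ) → ℕ
ΣFin {zero}  f = 0
ΣFin {suc n} f = f zero ℕ.+ ΣFin (λ i → f (suc i))

ΣFinℤ : ∀ {n} → (Fin n → ℤ) → ℤ
ΣFinℤ {zero}  f = + 0
ΣFinℤ {suc n} f = f zero ℤ.+ ΣFinℤ (λ i → f (suc i))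

-- extend a k-tuple to all of ℕ (value 0 outside 0..k-1), so that ranges of indices can be summed
ext : ∀ {k} → (Fin k → ℕ) → ℕ → ℕ
ext {k} r j with j <? k
... | yes j<k = r (fromℕ< j<k)
... | no  _   = 0

Σrange : ℕ → ℕ → (ℕ → ℕ) → ℕ
Σrange lo zero    f = 0
Σrange lo (suc n) f with lo ≤? n
... | yes _ = Σrange lo n f ℕ.+ f n
... | no  _ = 0

box : ∀ k → (Fin k → ℕ) → List (Fin k → ℕ)
box zero    r = (λ ()) ∷ []
box (suc k) r = concatMap (λ x → map (λ s → cons x s) (box k (λ i → r (suc i)))) (upTo (suc (r zero)))
  where
  cons : ℕ → (Fin k → ℕ) → Fin (suc k) → ℕ
  cons x s zero    = x
  cons x s (suc i) = s i

-- list enumerating the elements of h^(r) A (possibly with repetitions)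
restrictedSumsList : ∀ {k} → (Fin k → ℕ) → ℕ → (Fin k → ℤ) → List ℤ
restrictedSumsList {k} r h a =
  map (λ s → ΣFinℤ (λ i → + (s i) ℤ.* a i))
      (filter (λ s → ΣFin s ℕ.≟ h) (box k r))

restrictedSumsetSize : ∀ {k} → (Fin k → ℕ) → ℕ → (Fin k → ℤ) → ℕ
restrictedSumsetSize r h a = length (deduplicate ℤ._≟_ (restrictedSumsList r h a))

-- largest m ≤ n with p m (0 if none)
largestUpTo : (ℕ → Bool) → ℕ → ℕ
largestUpTo p zero    = 0
largestUpTo p (suc n) = if p (suc n) then suc n else largestUpTo p n

-- least m ≤ n with p m (n if none)
leastUpTo : (ℕ → Bool) → ℕ → ℕ
leastUpTo p zero    = 0
leastUpTo p (suc n) = if p 0 then 0 else suc (leastUpTo (λ m → p (suc m)) n)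

module _ {k : ℕ} (r : Fin k → ℕ) (h : ℕ) where

  Iᵣ : ℕ
  Iᵣ = largestUpTo (λ I → does (Σrange 0 I (ext r) ≤? h)) k

  Mᵣ+1 : ℕ
  Mᵣ+1 = leastUpTo (λ m → does (Σrange m k (ext r) ≤? h)) k

  -- M_r(h), with -1 ≤ M_r(h) ≤ k-1
  Mᵣ : ℤ
  Mᵣ = + Mᵣ+1 - + 1

  δᵣ : ℤ
  δᵣ = + h - + Σrange 0 Iᵣ (ext r)

  θᵣ : ℤ
  θᵣ = + h - + Σrange Mᵣ+1 k (ext r)

  L : ℤ
  L = + Σrange Mᵣ+1 k (λ j → j ℕ.* ext r j)
      - + Σrange 0 Iᵣ (λ j → j ℕ.* ext r j)
      ℤ.+ Mᵣ ℤ.* θᵣ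
      - + Iᵣ ℤ.* δᵣ
      ℤ.+ + 1

IsAP : ∀ {k} → (Fin k → ℤ) → Set
IsAP {k} a = Σ ℤ (λ c → Σ ℤ (λ d → (i : Fin k) → a i ≡ c ℤ.+ + toℕ i ℤ.* d))

-- the listing a_0 < a_1 < … < a_{k-1} of a k-element set of integers
StrictlyIncreasing : ∀ {k} → (Fin k → ℤ) → Set
StrictlyIncreasing {k} a = (i j : Fin k) → i Data.Fin.< j → a i ℤ.< a j

-- Call a tuple s with 0 ≤ sᵢ ≤ rᵢ and Σ sᵢ = h admissible; it contributes the sum Σ sᵢ aᵢ
-- to h^(r)A and has weight Σ i·sᵢ.  Moving one unit from position i to i + 1 raises the
-- weight by one and, as a is increasing, strictly raises the sum.  From every admissible
-- tuple such moves climb to the maximal weight W⁺ and descend to the minimal weight W⁻, so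
-- there are at least W⁺ − W⁻ + 1 distinct sums, and L(r,h) = W⁺ − W⁻ + 1 because the
-- extremal weights are attained by the tuples filling r greedily from the front and from
-- the back.  For an arithmetic progression c + i·d every sum equals hc + wd with
-- W⁻ ≤ w ≤ W⁺, whence equality.  Conversely, under equality two admissible tuples of equal
-- weight have equal sums (otherwise a descending chain from the smaller one and an
-- ascending chain from the larger one give W⁺ − W⁻ + 2 sums).  Comparing t + e_p + e_{u+1}
-- with t + e_{p+1} + e_u for p + 1 < u gives a_{p+1} − a_p = a_{u+1} − a_u, and for k ≥ 5
-- this makes all consecutive gaps equal.

module Submission where

open import Defs
open import Data.Nat using (ℕ; _≤_; _+_; _∸_)
open import Data.Fin using (Fin)
open import Data.Integer using (ℤ; +_)
open import Data.Product using (_×_)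
open import Function.Bundles using (_⇔_; mk⇔; Equivalence)
open import Relation.Binary.PropositionalEquality using (_≡_)

import Algebra.Properties.CommutativeSemigroup
open import Data.Bool using (Bool; true; false)
open import Data.Empty using (⊥-elim)
open import Data.Fin using (zero; suc; toℕ; fromℕ<)
import Data.Fin.Properties as Finₚ
import Data.Integer as ℤ
import Data.Integer.Properties as ℤₚ
import Data.Integer.Tactic.RingSolver as ℤ-Solver
open import Data.List using (List; []; _∷_; _++_; map; concatMap; upTo; length; deduplicate)
open import Data.List.Membership.Propositional using (_∈_; find; lose)
import Data.List.Membership.Propositional.Properties as ∈ₚ
import Data.List.Properties as List
open import Data.List.Relation.Unary.All as All using (All; []; _∷_)
import Data.List.Relation.Unary.All.Properties as Allₚ
open import Data.List.Relation.Unary.AllPairs using ([]; _∷_)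
open import Data.List.Relation.Unary.Any using (here; there; index; _─_)
open import Data.List.Relation.Unary.Unique.DecPropositional.Properties using (deduplicate-!)
open import Data.List.Relation.Unary.Unique.Propositional using (Unique)
import Data.List.Relation.Unary.Unique.Propositional.Properties as Uniqueₚ
import Data.Nat as ℕ
open import Data.Nat using (zero; suc; pred; >-nonZero; _<_; _*_; _⊓_; z≤n; s≤s; _≤?_; _<?_)
import Data.Nat.Properties as ℕₚ
import Data.Nat.Tactic.RingSolver as ℕ-Solver
open import Data.Product using (Σ; ∃; _,_; proj₁; proj₂)
open import Data.Sum using (_⊎_; inj₁; inj₂)
import Data.Sum as Sum
open import Data.Vec.Functional using (tail; updateAt)
import Data.Vec.Functional as Vector
open import Data.Vec.Functional.Properties
  using (updateAt-updates; updateAt-minimal; updateAt-updateAt; updateAt-id-local)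
open import Function using (_∘_; id)
open import Relation.Binary.Definitions using (tri<; tri≈; tri>)
open import Relation.Binary.PropositionalEquality
  using (refl; sym; trans; cong; cong₂; subst; subst₂; _≗_; _≢_; module ≡-Reasoning)
open import Relation.Nullary using (¬_; Dec; yes; no; does)
open import Relation.Nullary.Decidable using (dec-true)

module ℕ+ = Algebra.Properties.CommutativeSemigroup ℕₚ.+-commutativeSemigroup
module ℤ+ = Algebra.Properties.CommutativeSemigroup ℤₚ.+-commutativeSemigroup

-- Admissible tuples, their weights and values

infix 4 _≤ᵛ_
_≤ᵛ_ : ∀ {k} → (Fin k → ℕ) → (Fin k → ℕ) → Set
s ≤ᵛ r = ∀ i → s i ≤ r i

≤ᵛ-trans : ∀ {k} {s t u : Fin k → ℕ} → s ≤ᵛ t → t ≤ᵛ u → s ≤ᵛ u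
≤ᵛ-trans p q i = ℕₚ.≤-trans (p i) (q i)

ΣFin-cong : ∀ {k} {f g : Fin k → ℕ} → f ≗ g → ΣFin f ≡ ΣFin g
ΣFin-cong {zero}  f≗g = refl
ΣFin-cong {suc k} f≗g = cong₂ _+_ (f≗g zero) (ΣFin-cong (f≗g ∘ suc))

ΣFinℤ-cong : ∀ {k} {f g : Fin k → ℤ} → f ≗ g → ΣFinℤ f ≡ ΣFinℤ g
ΣFinℤ-cong {zero}  f≗g = refl
ΣFinℤ-cong {suc k} f≗g = cong₂ ℤ._+_ (f≗g zero) (ΣFinℤ-cong (f≗g ∘ suc))

ΣFin-+ : ∀ {k} (f g : Fin k → ℕ) → ΣFin (λ i → f i + g i) ≡ ΣFin f + ΣFin g
ΣFin-+ {zero}  f g = refl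
ΣFin-+ {suc k} f g = begin
  f zero + g zero + ΣFin (λ i → f (suc i) + g (suc i))
    ≡⟨ cong (_+_ (f zero + g zero)) (ΣFin-+ (tail f) (tail g)) ⟩
  f zero + g zero + (ΣFin (tail f) + ΣFin (tail g))
    ≡⟨ ℕ+.interchange (f zero) (g zero) _ _ ⟩
  f zero + ΣFin (tail f) + (g zero + ΣFin (tail g)) ∎
  where open ≡-Reasoning

ΣFin-mono : ∀ {k} {f g : Fin k → ℕ} → f ≤ᵛ g → ΣFin f ≤ ΣFin g
ΣFin-mono {zero}  f≤g = z≤n
ΣFin-mono {suc k} f≤g = ℕₚ.+-mono-≤ (f≤g zero) (ΣFin-mono (f≤g ∘ suc))

incAt decAt : ∀ {k} → (Fin k → ℕ) → Fin k → Fin k → ℕ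
incAt t j = updateAt t j suc
decAt t j = updateAt t j pred

incAt-decAt : ∀ {k} (t : Fin k → ℕ) j → 1 ≤ t j → incAt (decAt t j) j ≗ t
incAt-decAt t j 1≤tⱼ x =
  trans (updateAt-updateAt j t x) (updateAt-id-local j t (ℕₚ.suc-pred (t j) ⦃ >-nonZero 1≤tⱼ ⦄) x)

incAt-mono : ∀ {k} {t t′ : Fin k → ℕ} j → t ≤ᵛ t′ → incAt t j ≤ᵛ incAt t′ j
incAt-mono zero    t≤t′ zero    = s≤s (t≤t′ zero)
incAt-mono zero    t≤t′ (suc x) = t≤t′ (suc x)
incAt-mono (suc j) t≤t′ zero    = t≤t′ zero
incAt-mono (suc j) t≤t′ (suc x) = incAt-mono j (t≤t′ ∘ suc) x

decAt-≤ᵛ : ∀ {k} (t : Fin k → ℕ) j → decAt t j ≤ᵛ t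
decAt-≤ᵛ t zero    zero    = ℕₚ.pred[n]≤n
decAt-≤ᵛ t zero    (suc x) = ℕₚ.≤-refl
decAt-≤ᵛ t (suc j) zero    = ℕₚ.≤-refl
decAt-≤ᵛ t (suc j) (suc x) = decAt-≤ᵛ (tail t) j x

incAt-≤ᵛ : ∀ {k} {t r : Fin k → ℕ} j → 1 ≤ r j → t ≤ᵛ decAt r j → incAt t j ≤ᵛ r
incAt-≤ᵛ {r = r} j 1≤rⱼ t≤r-eⱼ = ≤ᵛ-trans (incAt-mono j t≤r-eⱼ) (ℕₚ.≤-reflexive ∘ incAt-decAt r j 1≤rⱼ)

ΣFin-incAt : ∀ {k} (t : Fin k → ℕ) j → ΣFin (incAt t j) ≡ suc (ΣFin t)
ΣFin-incAt t zero    = refl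
ΣFin-incAt t (suc j) = trans (cong (_+_ (t zero)) (ΣFin-incAt (tail t) j)) (ℕₚ.+-suc (t zero) _)

ΣFin-decAt : ∀ {k} (t : Fin k → ℕ) j → 1 ≤ t j → ΣFin t ≡ suc (ΣFin (decAt t j))
ΣFin-decAt t j 1≤tⱼ = trans (sym (ΣFin-cong (incAt-decAt t j 1≤tⱼ))) (ΣFin-incAt (decAt t j) j)

ΣFin-*-incAt : ∀ {k} (g t : Fin k → ℕ) j →
  ΣFin (λ i → g i * incAt t j i) ≡ g j + ΣFin (λ i → g i * t i)
ΣFin-*-incAt g t zero    = trans (cong (_+ ΣFin (λ i → g (suc i) * t (suc i))) (ℕₚ.*-suc (g zero) (t zero)))
                                 (ℕₚ.+-assoc (g zero) _ _)
ΣFin-*-incAt g t (suc j) = trans (cong (_+_ (g zero * t zero)) (ΣFin-*-incAt (tail g) (tail t) j))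
                                 (ℕ+.x∙yz≈y∙xz (g zero * t zero) (g (suc j)) _)

weight : ∀ {k} → (Fin k → ℕ) → ℕ
weight s = ΣFin (λ i → toℕ i * s i)

weight-incAt : ∀ {k} (t : Fin k → ℕ) j → weight (incAt t j) ≡ toℕ j + weight t
weight-incAt = ΣFin-*-incAt toℕ

weight-cong : ∀ {k} {s t : Fin k → ℕ} → s ≗ t → weight s ≡ weight t
weight-cong s≗t = ΣFin-cong (λ i → cong (toℕ i *_) (s≗t i))

weight-tail : ∀ {k} (s : Fin (suc k) → ℕ) → weight s ≡ ΣFin (tail s) + weight (tail s)
weight-tail s = ΣFin-+ (tail s) (λ i → toℕ i * s (suc i))

weight≤ : ∀ {k} (s : Fin k → ℕ) → weight s ≤ k * ΣFin s
weight≤ {zero}  s = z≤n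
weight≤ {suc k} s = begin
  weight s                          ≡⟨ weight-tail s ⟩
  ΣFin (tail s) + weight (tail s)   ≤⟨ ℕₚ.+-monoʳ-≤ (ΣFin (tail s)) (weight≤ (tail s)) ⟩
  ΣFin (tail s) + k * ΣFin (tail s) ≤⟨ ℕₚ.*-monoʳ-≤ (suc k) (ℕₚ.m≤n+m (ΣFin (tail s)) (s zero)) ⟩
  suc k * ΣFin s                    ∎
  where open ℕₚ.≤-Reasoning

weight-≡0 : ∀ {k} (s : Fin k → ℕ) → ΣFin s ≡ 0 → weight s ≡ 0
weight-≡0 {k} s Σs≡0 = ℕₚ.n≤0⇒n≡0 (subst (weight s ≤_) (trans (cong (k *_) Σs≡0) (ℕₚ.*-zeroʳ k)) (weight≤ s))

value : ∀ {k} → (Fin k → ℤ) → (Fin k → ℕ) → ℤ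
value a s = ΣFinℤ (λ i → + s i ℤ.* a i)

value-cong : ∀ {k} (a : Fin k → ℤ) {s t : Fin k → ℕ} → s ≗ t → value a s ≡ value a t
value-cong a s≗t = ΣFinℤ-cong (λ i → cong (λ x → + x ℤ.* a i) (s≗t i))

value-incAt : ∀ {k} (a : Fin k → ℤ) (t : Fin k → ℕ) j → value a (incAt t j) ≡ a j ℤ.+ value a t
value-incAt a t zero    = trans (cong (ℤ._+ value (tail a) (tail t)) (ℤₚ.suc-* (+ t zero) (a zero)))
                                (ℤₚ.+-assoc (a zero) _ _)
value-incAt a t (suc j) = trans (cong (ℤ._+_ (+ t zero ℤ.* a zero)) (value-incAt (tail a) (tail t) j))
                                (ℤ+.x∙yz≈y∙xz (+ t zero ℤ.* a zero) (a (suc j)) _)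

value-affine : ∀ {k} (c d : ℤ) (g s : Fin k → ℕ) →
  value (λ i → c ℤ.+ + g i ℤ.* d) s ≡ + ΣFin s ℤ.* c ℤ.+ + ΣFin (λ i → g i * s i) ℤ.* d
value-affine {zero}  c d g s = refl
value-affine {suc k} c d g s = begin
  + s₀ ℤ.* (c ℤ.+ + g₀ ℤ.* d) ℤ.+ value (λ i → c ℤ.+ + g (suc i) ℤ.* d) (tail s)
    ≡⟨ cong (ℤ._+_ (+ s₀ ℤ.* (c ℤ.+ + g₀ ℤ.* d))) (value-affine c d (tail g) (tail s)) ⟩
  + s₀ ℤ.* (c ℤ.+ + g₀ ℤ.* d) ℤ.+ (+ S ℤ.* c ℤ.+ + W ℤ.* d)
    ≡⟨ regroup c d (+ s₀) (+ g₀) (+ S) (+ W) ⟩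
  (+ s₀ ℤ.+ + S) ℤ.* c ℤ.+ (+ g₀ ℤ.* + s₀ ℤ.+ + W) ℤ.* d
    ≡⟨ cong (λ x → (+ s₀ ℤ.+ + S) ℤ.* c ℤ.+ (x ℤ.+ + W) ℤ.* d) (ℤₚ.pos-* g₀ s₀) ⟨
  + (s₀ + S) ℤ.* c ℤ.+ + (g₀ * s₀ + W) ℤ.* d ∎
  where
  open ≡-Reasoning
  s₀ g₀ S W : ℕ
  s₀ = s zero
  g₀ = g zero
  S = ΣFin (tail s)
  W = ΣFin (λ i → g (suc i) * s (suc i))
  regroup : ∀ (c d x y S W : ℤ) →
    x ℤ.* (c ℤ.+ y ℤ.* d) ℤ.+ (S ℤ.* c ℤ.+ W ℤ.* d) ≡ (x ℤ.+ S) ℤ.* c ℤ.+ (y ℤ.* x ℤ.+ W) ℤ.* d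
  regroup = ℤ-Solver.solve-∀

value-of-AP : ∀ {k} {a : Fin k → ℤ} {c d} → (∀ i → a i ≡ c ℤ.+ + toℕ i ℤ.* d) →
  ∀ s → value a s ≡ + ΣFin s ℤ.* c ℤ.+ + weight s ℤ.* d
value-of-AP {c = c} {d} a≡ s = trans (ΣFinℤ-cong (λ i → cong (ℤ._*_ (+ s i)) (a≡ i))) (value-affine c d toℕ s)

Positive : ∀ {k} → (Fin k → ℕ) → Set
Positive r = ∀ i → 1 ≤ r i

Admissible : ∀ {k} → (Fin k → ℕ) → ℕ → (Fin k → ℕ) → Set
Admissible r h s = s ≤ᵛ r × ΣFin s ≡ h

∃-admissible : ∀ {k} (r : Fin k → ℕ) {h} → h ≤ ΣFin r → ∃ (Admissible r h)
∃-admissible {zero}  r z≤n = (λ ()) , (λ ()) , refl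
∃-admissible {suc k} r {h} h≤Σr with h ≤? ΣFin (tail r)
... | yes h≤Σr′ = let s , s≤r′ , Σs≡h = ∃-admissible (tail r) h≤Σr′
                  in 0 Vector.∷ s , (λ { zero → z≤n ; (suc i) → s≤r′ i }) , Σs≡h
... | no  h≰Σr′ = (h ∸ ΣFin (tail r)) Vector.∷ tail r ,
                  (λ { zero → ℕₚ.m≤n+o⇒m∸n≤o h _ (subst (h ≤_) (ℕₚ.+-comm (r zero) _) h≤Σr) ; (suc i) → ℕₚ.≤-refl }) ,
                  ℕₚ.m∸n+n≡m (ℕₚ.<⇒≤ (ℕₚ.≰⇒> h≰Σr′))

-- Shifting one unit to a neighbouring position

Adjacent : ∀ {k} → Fin k → Fin k → Set
Adjacent i j = toℕ j ≡ suc (toℕ i)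

Adjacent⇒< : ∀ {k} {i j : Fin k} → Adjacent i j → toℕ i < toℕ j
Adjacent⇒< i~j = ℕₚ.≤-reflexive (sym i~j)

record Move {k} (r s : Fin k → ℕ) (i j : Fin k) : Set where
  constructor move
  field
    rest      : Fin k → ℕ
    source≗   : s ≗ incAt rest i
    target≤ᵛr : incAt rest j ≤ᵛ r

module _ {k} {r s : Fin k → ℕ} {i j : Fin k} (m : Move r s i j) where
  open Move m

  target : Fin k → ℕ
  target = incAt rest j

  target-admissible : ∀ {h} → Admissible r h s → Admissible r h target
  target-admissible (_ , Σs≡h) =
    target≤ᵛr , trans (ΣFin-incAt rest j) (trans (sym (ΣFin-incAt rest i)) (trans (sym (ΣFin-cong source≗)) Σs≡h))

  weight-source : weight s ≡ toℕ i + weight rest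
  weight-source = trans (weight-cong source≗) (weight-incAt rest i)

  value-source : ∀ a → value a s ≡ a i ℤ.+ value a rest
  value-source a = trans (value-cong a source≗) (value-incAt a rest i)

Move-weight-up : ∀ {k} {r s : Fin k → ℕ} {i j} → Adjacent i j → (m : Move r s i j) →
  weight (target m) ≡ suc (weight s)
Move-weight-up {j = j} i~j m =
  trans (weight-incAt (Move.rest m) j) (trans (cong (_+ _) i~j) (cong suc (sym (weight-source m))))

Move-weight-down : ∀ {k} {r s : Fin k → ℕ} {i j} → Adjacent i j → (m : Move r s j i) →
  weight s ≡ suc (weight (target m))
Move-weight-down {i = i} i~j m =
  trans (weight-source m) (trans (cong (_+ _) i~j) (cong suc (sym (weight-incAt (Move.rest m) i))))

Move-value-up : ∀ {k} {r s : Fin k → ℕ} {i j} {a : Fin k → ℤ} → StrictlyIncreasing a →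
  Adjacent i j → (m : Move r s i j) → value a s ℤ.< value a (target m)
Move-value-up {i = i} {j} {a} a↑ i~j m =
  subst₂ ℤ._<_ (sym (value-source m a)) (sym (value-incAt a (Move.rest m) j))
         (ℤₚ.+-monoˡ-< (value a (Move.rest m)) (a↑ i j (Adjacent⇒< i~j)))

Move-value-down : ∀ {k} {r s : Fin k → ℕ} {i j} {a : Fin k → ℤ} → StrictlyIncreasing a →
  Adjacent i j → (m : Move r s j i) → value a (target m) ℤ.< value a s
Move-value-down {i = i} {j} {a} a↑ i~j m =
  subst₂ ℤ._<_ (sym (value-incAt a (Move.rest m) i)) (sym (value-source m a))
         (ℤₚ.+-monoˡ-< (value a (Move.rest m)) (a↑ i j (Adjacent⇒< i~j)))

ShiftUp ShiftDown : ∀ {k} → (r s : Fin k → ℕ) → Set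
ShiftUp   {k} r s = Σ (Fin k) λ i → Σ (Fin k) λ j → Adjacent i j × Move r s i j
ShiftDown {k} r s = Σ (Fin k) λ i → Σ (Fin k) λ j → Adjacent i j × Move r s j i

Move-cons : ∀ {k} {r s : Fin (suc k) → ℕ} {i j} → s zero ≤ r zero →
  Move (tail r) (tail s) i j → Move r s (suc i) (suc j)
Move-cons {s = s} s₀≤r₀ (move t s≗ t≤r) =
  move (s zero Vector.∷ t) (λ { zero → refl ; (suc x) → s≗ x }) (λ { zero → s₀≤r₀ ; (suc x) → t≤r x })

ShiftUp-cons : ∀ {k} {r s : Fin (suc k) → ℕ} → s zero ≤ r zero → ShiftUp (tail r) (tail s) → ShiftUp r s
ShiftUp-cons s₀≤r₀ (i , j , i~j , m) = suc i , suc j , cong suc i~j , Move-cons s₀≤r₀ m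

ShiftDown-cons : ∀ {k} {r s : Fin (suc k) → ℕ} → s zero ≤ r zero → ShiftDown (tail r) (tail s) → ShiftDown r s
ShiftDown-cons s₀≤r₀ (i , j , i~j , m) = suc i , suc j , cong suc i~j , Move-cons s₀≤r₀ m

-- Weights of the admissible tuples filling r greedily from the front, resp. from the back.
minWeight maxWeight : ∀ k → (Fin k → ℕ) → ℕ → ℕ
minWeight zero    r h = 0
minWeight (suc k) r h = (h ∸ r zero) + minWeight k (tail r) (h ∸ r zero)
maxWeight zero    r h = 0
maxWeight (suc k) r h = h ⊓ ΣFin (tail r) + maxWeight k (tail r) (h ⊓ ΣFin (tail r))

minWeight-zero : ∀ k (r : Fin k → ℕ) → minWeight k r 0 ≡ 0
minWeight-zero zero    r = refl
minWeight-zero (suc k) r rewrite ℕₚ.0∸n≡0 (r zero) = minWeight-zero k (tail r)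

maxWeight-ΣFin : ∀ k (r : Fin k → ℕ) → maxWeight k r (ΣFin r) ≡ weight r
maxWeight-ΣFin zero    r = refl
maxWeight-ΣFin (suc k) r = begin
  ΣFin r ⊓ Σr′ + maxWeight k (tail r) (ΣFin r ⊓ Σr′)
    ≡⟨ cong (λ x → x + maxWeight k (tail r) x) (ℕₚ.m≥n⇒m⊓n≡n (ℕₚ.m≤n+m Σr′ (r zero))) ⟩
  Σr′ + maxWeight k (tail r) Σr′ ≡⟨ cong (_+_ Σr′) (maxWeight-ΣFin k (tail r)) ⟩
  Σr′ + weight (tail r)          ≡⟨ weight-tail r ⟨
  weight r                       ∎
  where
  open ≡-Reasoning
  Σr′ : ℕ
  Σr′ = ΣFin (tail r)

shiftDown-or-tail-empty : ∀ {k} (r s : Fin (suc k) → ℕ) → Positive r → s ≤ᵛ r → s zero < r zero →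
  ShiftDown r s ⊎ ΣFin (tail s) ≡ 0
shiftDown-or-tail-empty {zero}  r s pos s≤r s₀<r₀ = inj₂ refl
shiftDown-or-tail-empty {suc k} r s pos s≤r s₀<r₀ with s (suc zero) in s₁≡
... | suc _ = inj₁ (zero , suc zero , refl , move (decAt s (suc zero)) source≗ target≤ᵛr)
  where
  source≗ : s ≗ incAt (decAt s (suc zero)) (suc zero)
  source≗ x = sym (incAt-decAt s (suc zero) (subst (1 ≤_) (sym s₁≡) (s≤s z≤n)) x)
  target≤ᵛr : incAt (decAt s (suc zero)) zero ≤ᵛ r
  target≤ᵛr zero          = s₀<r₀
  target≤ᵛr (suc zero)    = ℕₚ.≤-trans ℕₚ.pred[n]≤n (s≤r (suc zero))
  target≤ᵛr (suc (suc x)) = s≤r (suc (suc x))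
... | zero = Sum.map (ShiftDown-cons (s≤r zero)) id
               (shiftDown-or-tail-empty (tail r) (tail s) (pos ∘ suc) (s≤r ∘ suc)
                 (subst (_< r (suc zero)) (sym s₁≡) (pos (suc zero))))

shiftDown-or-minWeight : ∀ {k} {r : Fin k → ℕ} → Positive r → ∀ {h s} → Admissible r h s →
  ShiftDown r s ⊎ weight s ≡ minWeight k r h
shiftDown-or-minWeight {zero} pos _ = inj₂ refl
shiftDown-or-minWeight {suc k} {r} pos {h} {s} (s≤r , Σs≡h) with ℕₚ.m≤n⇒m<n∨m≡n (s≤r zero)
... | inj₁ s₀<r₀ = Sum.map₂ weight≡ (shiftDown-or-tail-empty r s pos s≤r s₀<r₀)
  where
  weight≡ : ΣFin (tail s) ≡ 0 → weight s ≡ minWeight (suc k) r h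
  weight≡ Σtail≡0 = begin
    weight s                        ≡⟨ weight-tail s ⟩
    ΣFin (tail s) + weight (tail s) ≡⟨ cong₂ _+_ Σtail≡0 (weight-≡0 (tail s) Σtail≡0) ⟩
    0                               ≡⟨ minWeight-zero k (tail r) ⟨
    minWeight k (tail r) 0          ≡⟨ cong (λ x → x + minWeight k (tail r) x) h∸r₀≡0 ⟨
    minWeight (suc k) r h           ∎
    where
    open ≡-Reasoning
    h≡s₀ : h ≡ s zero
    h≡s₀ = trans (sym Σs≡h) (trans (cong (_+_ (s zero)) Σtail≡0) (ℕₚ.+-identityʳ (s zero)))
    h∸r₀≡0 : h ∸ r zero ≡ 0
    h∸r₀≡0 = ℕₚ.m≤n⇒m∸n≡0 (subst (_≤ r zero) (sym h≡s₀) (ℕₚ.<⇒≤ s₀<r₀))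
... | inj₂ s₀≡r₀ = Sum.map (ShiftDown-cons (s≤r zero))
                           (λ w≡ → trans (weight-tail s) (cong₂ _+_ Σtail≡h∸r₀ w≡))
                           (shiftDown-or-minWeight (pos ∘ suc) (s≤r ∘ suc , Σtail≡h∸r₀))
  where
  Σtail≡h∸r₀ : ΣFin (tail s) ≡ h ∸ r zero
  Σtail≡h∸r₀ = trans (sym (ℕₚ.m+n∸m≡n (s zero) _)) (cong₂ _∸_ Σs≡h s₀≡r₀)

shiftUp-or-tail-full : ∀ {k} (r s : Fin (suc k) → ℕ) → Positive r → s ≤ᵛ r → 1 ≤ s zero →
  ShiftUp r s ⊎ tail s ≗ tail r
shiftUp-or-tail-full {zero}  r s pos s≤r 1≤s₀ = inj₂ (λ ())
shiftUp-or-tail-full {suc k} r s pos s≤r 1≤s₀ with ℕₚ.m≤n⇒m<n∨m≡n (s≤r (suc zero))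
... | inj₁ s₁<r₁ = inj₁ (zero , suc zero , refl , move (decAt s zero) source≗ target≤ᵛr)
  where
  source≗ : s ≗ incAt (decAt s zero) zero
  source≗ x = sym (incAt-decAt s zero 1≤s₀ x)
  target≤ᵛr : incAt (decAt s zero) (suc zero) ≤ᵛ r
  target≤ᵛr zero          = ℕₚ.≤-trans ℕₚ.pred[n]≤n (s≤r zero)
  target≤ᵛr (suc zero)    = s₁<r₁
  target≤ᵛr (suc (suc x)) = s≤r (suc (suc x))
... | inj₂ s₁≡r₁ = Sum.map (ShiftUp-cons (s≤r zero)) (λ { tail≗ zero → s₁≡r₁ ; tail≗ (suc x) → tail≗ x })
                     (shiftUp-or-tail-full (tail r) (tail s) (pos ∘ suc) (s≤r ∘ suc)
                       (subst (1 ≤_) (sym s₁≡r₁) (pos (suc zero))))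

shiftUp-or-maxWeight : ∀ {k} {r : Fin k → ℕ} → Positive r → ∀ {h s} → Admissible r h s →
  ShiftUp r s ⊎ weight s ≡ maxWeight k r h
shiftUp-or-maxWeight {zero} pos _ = inj₂ refl
shiftUp-or-maxWeight {suc k} {r} pos {h} {s} (s≤r , Σs≡h) with s zero in s₀≡
... | zero  = Sum.map (ShiftUp-cons (s≤r zero)) weight≡
                (shiftUp-or-maxWeight (pos ∘ suc) (s≤r ∘ suc , Σs≡h))
  where
  h⊓Σr′≡h : h ⊓ ΣFin (tail r) ≡ h
  h⊓Σr′≡h = ℕₚ.m≤n⇒m⊓n≡m (subst (_≤ ΣFin (tail r)) Σs≡h (ΣFin-mono (s≤r ∘ suc)))
  weight≡ : weight (tail s) ≡ maxWeight k (tail r) h → weight s ≡ maxWeight (suc k) r h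
  weight≡ w≡ = begin
    weight s                                            ≡⟨ weight-tail s ⟩
    ΣFin (tail s) + weight (tail s)                     ≡⟨ cong₂ _+_ Σs≡h w≡ ⟩
    h + maxWeight k (tail r) h                          ≡⟨ cong (λ x → x + maxWeight k (tail r) x) h⊓Σr′≡h ⟨
    maxWeight (suc k) r h                               ∎
    where open ≡-Reasoning
... | suc m = Sum.map₂ weight≡ (shiftUp-or-tail-full r s pos s≤r (subst (1 ≤_) (sym s₀≡) (s≤s z≤n)))
  where
  weight≡ : tail s ≗ tail r → weight s ≡ maxWeight (suc k) r h
  weight≡ tail≗ = begin
    weight s                                            ≡⟨ weight-tail s ⟩
    ΣFin (tail s) + weight (tail s)                     ≡⟨ cong₂ _+_ Σtail≡ (weight-cong tail≗) ⟩
    ΣFin (tail r) + weight (tail r)                     ≡⟨ cong (_+_ (ΣFin (tail r))) (maxWeight-ΣFin k (tail r)) ⟨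
    ΣFin (tail r) + maxWeight k (tail r) (ΣFin (tail r)) ≡⟨ cong (λ x → x + maxWeight k (tail r) x) h⊓Σr′≡Σr′ ⟨
    maxWeight (suc k) r h                               ∎
    where
    open ≡-Reasoning
    Σtail≡ : ΣFin (tail s) ≡ ΣFin (tail r)
    Σtail≡ = ΣFin-cong tail≗
    h⊓Σr′≡Σr′ : h ⊓ ΣFin (tail r) ≡ ΣFin (tail r)
    h⊓Σr′≡Σr′ = ℕₚ.m≥n⇒m⊓n≡n (subst (ΣFin (tail r) ≤_) Σs≡h
                  (subst (_≤ suc m + ΣFin (tail s)) Σtail≡ (ℕₚ.m≤n+m (ΣFin (tail s)) (suc m))))

-- Chains of distinct sums

∈-concatMap-map⁻ : ∀ {A B C : Set} (g : A → B → C) ys xs {z} →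
  z ∈ concatMap (λ x → map (g x) ys) xs → ∃ λ x → ∃ λ y → x ∈ xs × y ∈ ys × z ≡ g x y
∈-concatMap-map⁻ g ys xs z∈ with find (∈ₚ.∈-concatMap⁻ (λ x → map (g x) ys) z∈)
... | x , x∈ , z∈′ with ∈ₚ.∈-map⁻ (g x) z∈′
...   | y , y∈ , z≡ = x , y , x∈ , y∈ , z≡

box-complete : ∀ k (r s : Fin k → ℕ) → s ≤ᵛ r → ∃ λ s′ → s′ ∈ box k r × s ≗ s′
box-complete zero    r s s≤r = _ , here refl , λ ()
box-complete (suc k) r s s≤r with box-complete k (tail r) (tail s) (s≤r ∘ suc)
... | s′ , s′∈ , tail≗ =
  _ , ∈ₚ.∈-concatMap⁺ _ (lose (∈ₚ.∈-upTo⁺ (s≤s (s≤r zero))) (∈ₚ.∈-map⁺ _ s′∈)) ,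
  λ { zero → refl ; (suc i) → tail≗ i }

box-sound : ∀ k (r s : Fin k → ℕ) → s ∈ box k r → s ≤ᵛ r
box-sound zero    r s s∈ = λ ()
box-sound (suc k) r s s∈ with ∈-concatMap-map⁻ _ (box k (tail r)) (upTo (suc (r zero))) s∈
... | x , s′ , x∈ , s′∈ , refl = λ { zero    → ℕₚ.≤-pred (∈ₚ.∈-upTo⁻ x∈)
                                  ; (suc i) → box-sound k (tail r) s′ s′∈ i }

module _ {k} (r : Fin k → ℕ) (h : ℕ) (a : Fin k → ℤ) where

  value∈sums : ∀ {s} → Admissible r h s → value a s ∈ restrictedSumsList r h a
  value∈sums {s} (s≤r , Σs≡h) with box-complete k r s s≤r
  ... | s′ , s′∈ , s≗s′ = subst (_∈ restrictedSumsList r h a) (sym (value-cong a s≗s′))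
          (∈ₚ.∈-map⁺ _ (∈ₚ.∈-filter⁺ (λ s → ΣFin s ℕ.≟ h) s′∈ (trans (sym (ΣFin-cong s≗s′)) Σs≡h)))

  ∈sums⇒admissible : ∀ {v} → v ∈ restrictedSumsList r h a → ∃ λ s → Admissible r h s × v ≡ value a s
  ∈sums⇒admissible v∈ with ∈ₚ.∈-map⁻ _ v∈
  ... | s , s∈ , refl with ∈ₚ.∈-filter⁻ (λ s → ΣFin s ℕ.≟ h) s∈
  ...   | s∈box , Σs≡h = s , (box-sound k r s s∈box , Σs≡h) , refl

module Chains {k} {r : Fin k → ℕ} (pos : Positive r) (h : ℕ) {a : Fin k → ℤ} (a↑ : StrictlyIncreasing a) where

  record ChainAbove (s : Fin k → ℕ) : Set where
    field
      values  : List ℤ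
      unique  : Unique values
      ⊆sums   : All (_∈ restrictedSumsList r h a) values
      above   : All (value a s ℤ.<_) values
      length≡ : length values + weight s ≡ maxWeight k r h

  record ChainBelow (s : Fin k → ℕ) : Set where
    field
      values  : List ℤ
      unique  : Unique values
      ⊆sums   : All (_∈ restrictedSumsList r h a) values
      below   : All (ℤ._< value a s) values
      length≡ : length values + minWeight k r h ≡ weight s

  -- Recursion on fuel: weight s ≤ k·h bounds the number of upward shifts, weight s that of downward ones.
  chainAbove-fuel : ∀ n {s} → Admissible r h s → weight s + n ≡ k * h → ChainAbove s
  chainAbove-fuel n {s} adm w+n≡ with shiftUp-or-maxWeight pos adm
  ... | inj₂ w≡ = record { values = [] ; unique = [] ; ⊆sums = [] ; above = [] ; length≡ = w≡ }
  ... | inj₁ (i , j , i~j , m) = extend n w+n≡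
    where
    s′ : Fin k → ℕ
    s′ = target m
    adm′ : Admissible r h s′
    adm′ = target-admissible m adm
    w′≡ : weight s′ ≡ suc (weight s)
    w′≡ = Move-weight-up i~j m
    s<s′ : value a s ℤ.< value a s′
    s<s′ = Move-value-up a↑ i~j m
    extend : ∀ n → weight s + n ≡ k * h → ChainAbove s
    extend zero    w+0≡ = ⊥-elim (ℕₚ.<-irrefl refl (begin-strict
      k * h        ≡⟨ trans (sym w+0≡) (ℕₚ.+-identityʳ (weight s)) ⟩
      weight s     <⟨ ℕₚ.n<1+n (weight s) ⟩
      suc (weight s) ≡⟨ w′≡ ⟨
      weight s′    ≤⟨ subst (λ x → weight s′ ≤ k * x) (proj₂ adm′) (weight≤ s′) ⟩
      k * h        ∎))
      where open ℕₚ.≤-Reasoning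
    extend (suc n) w+1+n≡ = record
      { values  = value a s′ ∷ values
      ; unique  = All.map (λ s′<v s′≡v → ℤₚ.<-irrefl s′≡v s′<v) above ∷ unique
      ; ⊆sums   = value∈sums r h a adm′ ∷ ⊆sums
      ; above   = s<s′ ∷ All.map (ℤₚ.<-trans s<s′) above
      ; length≡ = trans (sym (ℕₚ.+-suc (length values) (weight s))) (trans (cong (_+_ (length values)) (sym w′≡)) length≡)
      }
      where
      open ChainAbove (chainAbove-fuel n adm′ (trans (cong (_+ n) w′≡) (trans (sym (ℕₚ.+-suc (weight s) n)) w+1+n≡)))

  chainBelow-fuel : ∀ n {s} → Admissible r h s → weight s ≡ n → ChainBelow s
  chainBelow-fuel n {s} adm w≡n with shiftDown-or-minWeight pos adm
  ... | inj₂ w≡ = record { values = [] ; unique = [] ; ⊆sums = [] ; below = [] ; length≡ = sym w≡ }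
  ... | inj₁ (i , j , i~j , m) = extend n w≡n
    where
    s′ : Fin k → ℕ
    s′ = target m
    adm′ : Admissible r h s′
    adm′ = target-admissible m adm
    w≡ : weight s ≡ suc (weight s′)
    w≡ = Move-weight-down i~j m
    s′<s : value a s′ ℤ.< value a s
    s′<s = Move-value-down a↑ i~j m
    extend : ∀ n → weight s ≡ n → ChainBelow s
    extend zero    w≡0 with trans (sym w≡) w≡0
    ... | ()
    extend (suc n) w≡1+n = record
      { values  = value a s′ ∷ values
      ; unique  = All.map (λ v<s′ s′≡v → ℤₚ.<-irrefl (sym s′≡v) v<s′) below ∷ unique
      ; ⊆sums   = value∈sums r h a adm′ ∷ ⊆sums
      ; below   = s′<s ∷ All.map (λ v<s′ → ℤₚ.<-trans v<s′ s′<s) below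
      ; length≡ = trans (cong suc length≡) (sym w≡)
      }
      where
      open ChainBelow (chainBelow-fuel n adm′ (ℕₚ.suc-injective (trans (sym w≡) w≡1+n)))

  chainAbove : ∀ {s} → Admissible r h s → ChainAbove s
  chainAbove {s} adm = chainAbove-fuel (k * h ∸ weight s) adm
    (ℕₚ.m+[n∸m]≡n (subst (λ x → weight s ≤ k * x) (proj₂ adm) (weight≤ s)))

  chainBelow : ∀ {s} → Admissible r h s → ChainBelow s
  chainBelow adm = chainBelow-fuel _ adm refl

  minWeight≤weight : ∀ {s} → Admissible r h s → minWeight k r h ≤ weight s
  minWeight≤weight adm = subst (minWeight k r h ≤_) length≡ (ℕₚ.m≤n+m _ (length values))
    where open ChainBelow (chainBelow adm)

  weight≤maxWeight : ∀ {s} → Admissible r h s → weight s ≤ maxWeight k r h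
  weight≤maxWeight {s} adm = subst (weight s ≤_) length≡ (ℕₚ.m≤n+m _ (length values))
    where open ChainAbove (chainAbove adm)

∈-─ : ∀ {A : Set} {x y : A} {ys} → x ∈ ys → x ≢ y → (y∈ : y ∈ ys) → x ∈ (ys ─ y∈)
∈-─ (here refl) x≢y (here refl) = ⊥-elim (x≢y refl)
∈-─ (here x≡)   x≢y (there _)   = here x≡
∈-─ (there x∈)  x≢y (here _)    = x∈
∈-─ (there x∈)  x≢y (there y∈)  = there (∈-─ x∈ x≢y y∈)

Unique-⊆⇒length≤ : ∀ {A : Set} {xs ys : List A} → Unique xs → (∀ {x} → x ∈ xs → x ∈ ys) → length xs ≤ length ys
Unique-⊆⇒length≤ {xs = []}     _              _  = z≤n
Unique-⊆⇒length≤ {xs = x ∷ xs} {ys} (x∉ ∷ !xs) xs⊆ = begin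
  suc (length xs)                     ≤⟨ s≤s (Unique-⊆⇒length≤ !xs xs⊆ys─x) ⟩
  suc (length (ys ─ x∈ys))            ≡⟨ List.length-removeAt′ ys (index x∈ys) ⟨
  length ys                           ∎
  where
  open ℕₚ.≤-Reasoning
  x∈ys : x ∈ ys
  x∈ys = xs⊆ (here refl)
  xs⊆ys─x : ∀ {y} → y ∈ xs → y ∈ (ys ─ x∈ys)
  xs⊆ys─x y∈ = ∈-─ (xs⊆ (there y∈)) (λ y≡x → All.lookup x∉ y∈ (sym y≡x)) x∈ys

module Counting {k} {r : Fin k → ℕ} (pos : Positive r) {h : ℕ} (h≤Σr : h ≤ ΣFin r)
                {a : Fin k → ℤ} (a↑ : StrictlyIncreasing a) where
  open Chains pos h a↑

  sums : List ℤ
  sums = restrictedSumsList r h a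

  size minW maxW : ℕ
  size = restrictedSumsetSize r h a
  minW = minWeight k r h
  maxW = maxWeight k r h

  -- The chain below s₁, then mid, then the chain above s₂ consist of distinct sums.
  count-between : ∀ {s₁ s₂} → Admissible r h s₁ → Admissible r h s₂ → weight s₁ ≡ weight s₂ →
    value a s₁ ℤ.≤ value a s₂ → ∀ mid → Unique mid → All (_∈ sums) mid →
    All (λ v → value a s₁ ℤ.≤ v × v ℤ.≤ value a s₂) mid →
    length mid + maxW ≤ size + minW
  count-between {s₁} {s₂} adm₁ adm₂ w₁≡w₂ s₁≤s₂ mid !mid mid⊆sums mid-between = begin
    length mid + maxW
      ≡⟨ cong (_+_ (length mid)) (trans (sym ↑.length≡) (cong (_+_ (length ↑.values)) (trans (sym w₁≡w₂) (sym ↓.length≡)))) ⟩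
    length mid + (length ↑.values + (length ↓.values + minW))
      ≡⟨ regroup (length ↓.values) (length mid) (length ↑.values) minW ⟩
    length ↓.values + (length mid + length ↑.values) + minW
      ≡⟨ cong (_+ minW) (trans (List.length-++ ↓.values) (cong (_+_ (length ↓.values)) (List.length-++ mid))) ⟨
    length T + minW
      ≤⟨ ℕₚ.+-monoˡ-≤ minW (Unique-⊆⇒length≤ !T T⊆distinct) ⟩
    size + minW ∎
    where
    open ℕₚ.≤-Reasoning
    module ↓ = ChainBelow (chainBelow adm₁)
    module ↑ = ChainAbove (chainAbove adm₂)
    T : List ℤ
    T = ↓.values ++ mid ++ ↑.values
    regroup : ∀ d m u w → m + (u + (d + w)) ≡ d + (m + u) + w
    regroup = ℕ-Solver.solve-∀
    s₁≤mid++↑ : All (value a s₁ ℤ.≤_) (mid ++ ↑.values)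
    s₁≤mid++↑ = Allₚ.++⁺ (All.map proj₁ mid-between) (All.map (λ s₂<v → ℤₚ.≤-trans s₁≤s₂ (ℤₚ.<⇒≤ s₂<v)) ↑.above)
    !T : Unique T
    !T = Uniqueₚ.++⁺ ↓.unique (Uniqueₚ.++⁺ !mid ↑.unique mid#↑) ↓#mid++↑
      where
      mid#↑ : ∀ {v} → ¬ (v ∈ mid × v ∈ ↑.values)
      mid#↑ (v∈mid , v∈↑) = ℤₚ.<-irrefl refl (ℤₚ.<-≤-trans (All.lookup ↑.above v∈↑) (proj₂ (All.lookup mid-between v∈mid)))
      ↓#mid++↑ : ∀ {v} → ¬ (v ∈ ↓.values × v ∈ mid ++ ↑.values)
      ↓#mid++↑ (v∈↓ , v∈rest) = ℤₚ.<-irrefl refl (ℤₚ.<-≤-trans (All.lookup ↓.below v∈↓) (All.lookup s₁≤mid++↑ v∈rest))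
    T⊆distinct : ∀ {v} → v ∈ T → v ∈ deduplicate ℤ._≟_ sums
    T⊆distinct = ∈ₚ.∈-deduplicate⁺ ℤ._≟_ ∘ All.lookup (Allₚ.++⁺ ↓.⊆sums (Allₚ.++⁺ mid⊆sums ↑.⊆sums))

  minWeight≤maxWeight : minW ≤ maxW
  minWeight≤maxWeight = let _ , adm = ∃-admissible r h≤Σr in ℕₚ.≤-trans (minWeight≤weight adm) (weight≤maxWeight adm)

  maxWeight<size+minWeight : suc maxW ≤ size + minW
  maxWeight<size+minWeight = let s , adm = ∃-admissible r h≤Σr in
    count-between adm adm refl ℤₚ.≤-refl (value a s ∷ []) ([] ∷ []) (value∈sums r h a adm ∷ []) ((ℤₚ.≤-refl , ℤₚ.≤-refl) ∷ [])

  extremal⇒¬value< : size + minW ≡ suc maxW → ∀ {s₁ s₂} → Admissible r h s₁ → Admissible r h s₂ →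
    weight s₁ ≡ weight s₂ → ¬ value a s₁ ℤ.< value a s₂
  extremal⇒¬value< extremal {s₁} {s₂} adm₁ adm₂ w≡ v₁<v₂ = ℕₚ.<-irrefl refl (subst (suc (suc maxW) ≤_) extremal
    (count-between adm₁ adm₂ w≡ (ℤₚ.<⇒≤ v₁<v₂) (value a s₁ ∷ value a s₂ ∷ [])
      ((ℤₚ.<⇒≢ v₁<v₂ ∷ []) ∷ [] ∷ [])
      (value∈sums r h a adm₁ ∷ value∈sums r h a adm₂ ∷ [])
      ((ℤₚ.≤-refl , ℤₚ.<⇒≤ v₁<v₂) ∷ (ℤₚ.<⇒≤ v₁<v₂ , ℤₚ.≤-refl) ∷ [])))

  extremal⇒weight-determines-value : size + minW ≡ suc maxW → ∀ {s₁ s₂} → Admissible r h s₁ → Admissible r h s₂ →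
    weight s₁ ≡ weight s₂ → value a s₁ ≡ value a s₂
  extremal⇒weight-determines-value extremal {s₁} {s₂} adm₁ adm₂ w≡ with ℤₚ.<-cmp (value a s₁) (value a s₂)
  ... | tri< v₁<v₂ _ _ = ⊥-elim (extremal⇒¬value< extremal adm₁ adm₂ w≡ v₁<v₂)
  ... | tri≈ _ v₁≡v₂ _ = v₁≡v₂
  ... | tri> _ _ v₂<v₁ = ⊥-elim (extremal⇒¬value< extremal adm₂ adm₁ (sym w≡) v₂<v₁)

  AP⇒size≤ : IsAP a → size + minW ≤ suc maxW
  AP⇒size≤ (c , d , a≡) = begin
    size + minW                  ≤⟨ ℕₚ.+-monoˡ-≤ minW (Unique-⊆⇒length≤ (deduplicate-! ℤ._≟_ sums) distinct⊆T) ⟩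
    length T + minW              ≡⟨ cong (_+ minW) (trans (List.length-map _ (upTo (suc (maxW ∸ minW)))) (List.length-upTo (suc (maxW ∸ minW)))) ⟩
    suc (maxW ∸ minW) + minW     ≡⟨ cong suc (ℕₚ.m∸n+n≡m minWeight≤maxWeight) ⟩
    suc maxW                     ∎
    where
    open ℕₚ.≤-Reasoning
    T : List ℤ
    T = map (λ n → + h ℤ.* c ℤ.+ + (minW + n) ℤ.* d) (upTo (suc (maxW ∸ minW)))
    distinct⊆T : ∀ {v} → v ∈ deduplicate ℤ._≟_ sums → v ∈ T
    distinct⊆T v∈ with ∈sums⇒admissible r h a (∈ₚ.∈-deduplicate⁻ ℤ._≟_ sums v∈)
    ... | s , adm , refl = subst (_∈ T) (sym (trans (value-of-AP a≡ s)
                               (cong₂ (λ x w → + x ℤ.* c ℤ.+ + w ℤ.* d) (proj₂ adm) (sym (ℕₚ.m+[n∸m]≡n (minWeight≤weight adm))))))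
                             (∈ₚ.∈-map⁺ _ (∈ₚ.∈-upTo⁺ (s≤s (ℕₚ.∸-monoˡ-≤ minW (weight≤maxWeight adm)))))

-- Equality forces an arithmetic progression

extℤ : ∀ {k} → (Fin k → ℤ) → ℕ → ℤ
extℤ {k} a n with n <? k
... | yes n<k = a (fromℕ< n<k)
... | no  _   = + 0

extℤ-fromℕ< : ∀ {k} (a : Fin k → ℤ) {n} (n<k : n < k) → extℤ a n ≡ a (fromℕ< n<k)
extℤ-fromℕ< {k} a {n} n<k with n <? k
... | yes _   = refl
... | no  n≮k = ⊥-elim (n≮k n<k)

extℤ-toℕ : ∀ {k} (a : Fin k → ℤ) i → extℤ a (toℕ i) ≡ a i
extℤ-toℕ a i = trans (extℤ-fromℕ< a (Finₚ.toℕ<n i)) (cong a (Finₚ.fromℕ<-toℕ i (Finₚ.toℕ<n i)))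

-- With k ≥ 5 the gap g 1 is linked to g 0 through g 3.
constant-gaps : ∀ {k} (g : ℕ → ℤ) → 5 ≤ k → (∀ {i j} → 2 + i ≤ j → suc j < k → g j ≡ g i) →
  ∀ {j} → suc j < k → g j ≡ g 0
constant-gaps g 5≤k far {zero}        _   = refl
constant-gaps g 5≤k far {suc zero}    _   = trans (sym (far {1} {3} ℕₚ.≤-refl 5≤k)) (far {0} {3} (s≤s (s≤s z≤n)) 5≤k)
constant-gaps g 5≤k far {suc (suc j)} 3+j<k = far (s≤s (s≤s z≤n)) 3+j<k

linear-by-gaps : ∀ {k} (f : ℕ → ℤ) {c} → (∀ {j} → suc j < k → f (suc j) ℤ.- f j ≡ c) →
  ∀ {j} → j < k → f j ≡ f 0 ℤ.+ + j ℤ.* c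
linear-by-gaps f     gaps {zero}  _     = sym (ℤₚ.+-identityʳ (f 0))
linear-by-gaps f {c} gaps {suc j} 1+j<k = begin
  f (suc j)                           ≡⟨ step (f (suc j)) (f j) ⟩
  f j ℤ.+ (f (suc j) ℤ.- f j)          ≡⟨ cong₂ ℤ._+_ (linear-by-gaps f gaps (ℕₚ.<-trans (ℕₚ.n<1+n j) 1+j<k)) (gaps 1+j<k) ⟩
  f 0 ℤ.+ + j ℤ.* c ℤ.+ c              ≡⟨ regroup (f 0) (+ j) c ⟩
  f 0 ℤ.+ (ℤ.+ 1 ℤ.+ + j) ℤ.* c        ∎
  where
  open ≡-Reasoning
  step : ∀ (y x : ℤ) → y ≡ x ℤ.+ (y ℤ.- x)
  step = ℤ-Solver.solve-∀
  regroup : ∀ (x n c : ℤ) → x ℤ.+ n ℤ.* c ℤ.+ c ≡ x ℤ.+ (ℤ.+ 1 ℤ.+ n) ℤ.* c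
  regroup = ℤ-Solver.solve-∀

equal-gaps⇒IsAP : ∀ {k} (a : Fin k → ℤ) → 5 ≤ k →
  (∀ {p q u v : Fin k} → Adjacent p q → Adjacent u v → toℕ q < toℕ u → a v ℤ.- a u ≡ a q ℤ.- a p) → IsAP a
equal-gaps⇒IsAP {k} a 5≤k gaps-equal = extℤ a 0 , gap 0 , λ i →
  trans (sym (extℤ-toℕ a i)) (linear-by-gaps (extℤ a) (λ 1+j<k → constant-gaps gap 5≤k far 1+j<k) (Finₚ.toℕ<n i))
  where
  gap : ℕ → ℤ
  gap n = extℤ a (suc n) ℤ.- extℤ a n
  far : ∀ {i j} → 2 + i ≤ j → suc j < k → gap j ≡ gap i
  far {i} {j} 2+i≤j 1+j<k = begin
    extℤ a (suc j) ℤ.- extℤ a j   ≡⟨ cong₂ ℤ._-_ (extℤ-fromℕ< a 1+j<k) (extℤ-fromℕ< a j<k) ⟩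
    a v ℤ.- a u                   ≡⟨ gaps-equal p~q u~v q<u ⟩
    a q ℤ.- a p                   ≡⟨ cong₂ ℤ._-_ (extℤ-fromℕ< a 1+i<k) (extℤ-fromℕ< a i<k) ⟨
    extℤ a (suc i) ℤ.- extℤ a i   ∎
    where
    open ≡-Reasoning
    j<k : j < k
    j<k = ℕₚ.<-trans (ℕₚ.n<1+n j) 1+j<k
    1+i<k : suc i < k
    1+i<k = ℕₚ.<-trans 2+i≤j j<k
    i<k : i < k
    i<k = ℕₚ.<-trans (ℕₚ.n<1+n i) 1+i<k
    p q u v : Fin k
    p = fromℕ< i<k
    q = fromℕ< 1+i<k
    u = fromℕ< j<k
    v = fromℕ< 1+j<k
    p~q : Adjacent p q
    p~q = trans (Finₚ.toℕ-fromℕ< 1+i<k) (cong suc (sym (Finₚ.toℕ-fromℕ< i<k)))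
    u~v : Adjacent u v
    u~v = trans (Finₚ.toℕ-fromℕ< 1+j<k) (cong suc (sym (Finₚ.toℕ-fromℕ< j<k)))
    q<u : toℕ q < toℕ u
    q<u = subst₂ _<_ (sym (Finₚ.toℕ-fromℕ< 1+i<k)) (sym (Finₚ.toℕ-fromℕ< j<k)) 2+i≤j

cancel-common : ∀ (x y x′ y′ F : ℤ) → x ℤ.+ (y ℤ.+ F) ≡ x′ ℤ.+ (y′ ℤ.+ F) → x ℤ.- x′ ≡ y′ ℤ.- y
cancel-common x y x′ y′ F eq = begin
  x ℤ.- x′                                    ≡⟨ expand x y x′ F ⟩
  x ℤ.+ (y ℤ.+ F) ℤ.- x′ ℤ.- y ℤ.- F          ≡⟨ cong (λ z → z ℤ.- x′ ℤ.- y ℤ.- F) eq ⟩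
  x′ ℤ.+ (y′ ℤ.+ F) ℤ.- x′ ℤ.- y ℤ.- F        ≡⟨ collapse x′ y′ y F ⟩
  y′ ℤ.- y                                    ∎
  where
  open ≡-Reasoning
  expand : ∀ (x y x′ F : ℤ) → x ℤ.- x′ ≡ x ℤ.+ (y ℤ.+ F) ℤ.- x′ ℤ.- y ℤ.- F
  expand = ℤ-Solver.solve-∀
  collapse : ∀ (x′ y′ y F : ℤ) → x′ ℤ.+ (y′ ℤ.+ F) ℤ.- x′ ℤ.- y ℤ.- F ≡ y′ ℤ.- y
  collapse = ℤ-Solver.solve-∀

∃-admissible-pair-extensions : ∀ {k} {r : Fin k → ℕ} → Positive r → ∀ {h} → 2 ≤ h → h + 2 ≤ ΣFin r →
  ∀ {p q u v : Fin k} → toℕ p < toℕ q → toℕ q < toℕ u → toℕ u < toℕ v →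
  ∃ λ t → Admissible r h (incAt (incAt t p) v) × Admissible r h (incAt (incAt t q) u)
∃-admissible-pair-extensions {k} {r} pos {h} 2≤h h+2≤Σr {p} {q} {u} {v} p<q q<u u<v =
  t , (s₁≤r , Σ≡h p v) , (s₂≤r , Σ≡h q u)
  where
  q<v : toℕ q < toℕ v
  q<v = ℕₚ.<-trans q<u u<v
  p<u : toℕ p < toℕ u
  p<u = ℕₚ.<-trans p<q q<u
  p<v : toℕ p < toℕ v
  p<v = ℕₚ.<-trans p<u u<v
  r₁ r₂ r₃ r₄ : Fin k → ℕ
  r₁ = decAt r v
  r₂ = decAt r₁ u
  r₃ = decAt r₂ q
  r₄ = decAt r₃ p
  1≤r₁u : 1 ≤ r₁ u
  1≤r₁u = subst (1 ≤_) (sym (updateAt-minimal u v r (Finₚ.<⇒≢ u<v))) (pos u)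
  1≤r₂q : 1 ≤ r₂ q
  1≤r₂q = subst (1 ≤_) (sym (trans (updateAt-minimal q u r₁ (Finₚ.<⇒≢ q<u)) (updateAt-minimal q v r (Finₚ.<⇒≢ q<v)))) (pos q)
  1≤r₃p : 1 ≤ r₃ p
  1≤r₃p = subst (1 ≤_) (sym (trans (updateAt-minimal p q r₂ (Finₚ.<⇒≢ p<q))
            (trans (updateAt-minimal p u r₁ (Finₚ.<⇒≢ p<u)) (updateAt-minimal p v r (Finₚ.<⇒≢ p<v))))) (pos p)
  Σr≡ : ΣFin r ≡ 4 + ΣFin r₄
  Σr≡ = trans (ΣFin-decAt r v (pos v)) (cong suc (trans (ΣFin-decAt r₁ u 1≤r₁u)
          (cong suc (trans (ΣFin-decAt r₂ q 1≤r₂q) (cong suc (ΣFin-decAt r₃ p 1≤r₃p))))))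
  h∸2≤Σr₄ : h ∸ 2 ≤ ΣFin r₄
  h∸2≤Σr₄ = ℕₚ.m≤n+o⇒m∸n≤o h 2 (ℕₚ.+-cancelʳ-≤ 2 h (2 + ΣFin r₄)
               (subst (h + 2 ≤_) (trans Σr≡ (ℕₚ.+-comm 2 (2 + ΣFin r₄))) h+2≤Σr))
  t : Fin k → ℕ
  t = proj₁ (∃-admissible r₄ h∸2≤Σr₄)
  t≤r₄ : t ≤ᵛ r₄
  t≤r₄ = proj₁ (proj₂ (∃-admissible r₄ h∸2≤Σr₄))
  Σ≡h : ∀ i j → ΣFin (incAt (incAt t i) j) ≡ h
  Σ≡h i j = trans (ΣFin-incAt _ j) (trans (cong suc (ΣFin-incAt t i))
              (trans (cong (_+_ 2) (proj₂ (proj₂ (∃-admissible r₄ h∸2≤Σr₄)))) (ℕₚ.m+[n∸m]≡n 2≤h)))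
  s₁≤r : incAt (incAt t p) v ≤ᵛ r
  s₁≤r = incAt-≤ᵛ v (pos v) (≤ᵛ-trans (incAt-≤ᵛ p 1≤r₃p t≤r₄) (≤ᵛ-trans (decAt-≤ᵛ r₂ q) (decAt-≤ᵛ r₁ u)))
  s₂≤r : incAt (incAt t q) u ≤ᵛ r
  s₂≤r = ≤ᵛ-trans (incAt-≤ᵛ u 1≤r₁u (incAt-≤ᵛ q 1≤r₂q (≤ᵛ-trans t≤r₄ (decAt-≤ᵛ r₃ p)))) (decAt-≤ᵛ r v)

module Rigidity {k} {r : Fin k → ℕ} (pos : Positive r) {h} (2≤h : 2 ≤ h) (h+2≤Σr : h + 2 ≤ ΣFin r)
                {a : Fin k → ℤ} (a↑ : StrictlyIncreasing a)
                (extremal : restrictedSumsetSize r h a + minWeight k r h ≡ suc (maxWeight k r h)) where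
  open Counting pos (ℕₚ.≤-trans (ℕₚ.m≤m+n h 2) h+2≤Σr) a↑

  gaps-equal : ∀ {p q u v : Fin k} → Adjacent p q → Adjacent u v → toℕ q < toℕ u → a v ℤ.- a u ≡ a q ℤ.- a p
  gaps-equal {p} {q} {u} {v} p~q u~v q<u
    with ∃-admissible-pair-extensions pos 2≤h h+2≤Σr (Adjacent⇒< p~q) q<u (Adjacent⇒< u~v)
  ... | t , adm₁ , adm₂ = cancel-common (a v) (a p) (a u) (a q) (value a t) (begin
    a v ℤ.+ (a p ℤ.+ value a t)            ≡⟨ trans (value-incAt a _ v) (cong (ℤ._+_ (a v)) (value-incAt a t p)) ⟨
    value a (incAt (incAt t p) v)          ≡⟨ extremal⇒weight-determines-value extremal adm₁ adm₂ weights≡ ⟩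
    value a (incAt (incAt t q) u)          ≡⟨ trans (value-incAt a _ u) (cong (ℤ._+_ (a u)) (value-incAt a t q)) ⟩
    a u ℤ.+ (a q ℤ.+ value a t)            ∎)
    where
    open ≡-Reasoning
    weights≡ : weight (incAt (incAt t p) v) ≡ weight (incAt (incAt t q) u)
    weights≡ = begin
      weight (incAt (incAt t p) v)           ≡⟨ trans (weight-incAt _ v) (cong (_+_ (toℕ v)) (weight-incAt t p)) ⟩
      toℕ v + (toℕ p + weight t)             ≡⟨ cong (λ x → x + (toℕ p + weight t)) u~v ⟩
      suc (toℕ u + (toℕ p + weight t))       ≡⟨ ℕₚ.+-suc (toℕ u) (toℕ p + weight t) ⟨
      toℕ u + (suc (toℕ p) + weight t)       ≡⟨ cong (λ x → toℕ u + (x + weight t)) p~q ⟨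
      toℕ u + (toℕ q + weight t)             ≡⟨ trans (weight-incAt _ u) (cong (_+_ (toℕ u)) (weight-incAt t q)) ⟨
      weight (incAt (incAt t q) u)           ∎

-- The closed form of L

sumTo : ℕ → (ℕ → ℕ) → ℕ
sumTo zero    F = 0
sumTo (suc n) F = F 0 + sumTo n (F ∘ suc)

ΣFin-toℕ : ∀ k (F : ℕ → ℕ) → ΣFin {k} (F ∘ toℕ) ≡ sumTo k F
ΣFin-toℕ zero    F = refl
ΣFin-toℕ (suc k) F = cong (_+_ (F 0)) (ΣFin-toℕ k (F ∘ suc))

sumTo-suc : ∀ n F → sumTo (suc n) F ≡ sumTo n F + F n
sumTo-suc zero    F = ℕₚ.+-comm (F 0) 0
sumTo-suc (suc n) F = trans (cong (_+_ (F 0)) (sumTo-suc n (F ∘ suc))) (sym (ℕₚ.+-assoc (F 0) _ _))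

sumTo-cong : ∀ n {F G : ℕ → ℕ} → (∀ j → j < n → F j ≡ G j) → sumTo n F ≡ sumTo n G
sumTo-cong zero    F≡G = refl
sumTo-cong (suc n) F≡G = cong₂ _+_ (F≡G 0 (s≤s z≤n)) (sumTo-cong n (λ j j<n → F≡G (suc j) (s≤s j<n)))

sumTo-zero : ∀ n → sumTo n (λ _ → 0) ≡ 0
sumTo-zero zero    = refl
sumTo-zero (suc n) = sumTo-zero n

Σrange-suc : ∀ m n F → m ≤ n → Σrange m (suc n) F ≡ Σrange m n F + F n
Σrange-suc m n F m≤n with m ≤? n
... | yes _   = refl
... | no  m≰n = ⊥-elim (m≰n m≤n)

Σrange-cong : ∀ m n {F G : ℕ → ℕ} → (∀ j → m ≤ j → F j ≡ G j) → Σrange m n F ≡ Σrange m n G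
Σrange-cong m zero    F≡G = refl
Σrange-cong m (suc n) F≡G with m ≤? n
... | yes m≤n = cong₂ _+_ (Σrange-cong m n F≡G) (F≡G n m≤n)
... | no  _   = refl

Σrange-zero : ∀ m n → Σrange m n (λ _ → 0) ≡ 0
Σrange-zero m zero    = refl
Σrange-zero m (suc n) with m ≤? n
... | yes _ = trans (ℕₚ.+-identityʳ _) (Σrange-zero m n)
... | no  _ = refl

Σrange-empty : ∀ n F → Σrange n n F ≡ 0
Σrange-empty zero    F = refl
Σrange-empty (suc n) F with suc n ≤? n
... | yes 1+n≤n = ⊥-elim (ℕₚ.<-irrefl refl 1+n≤n)
... | no  _     = refl

sumTo-split : ∀ {m n} F → m ≤ n → sumTo n F ≡ sumTo m F + Σrange m n F
sumTo-split {m} {zero}  F z≤n = refl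
sumTo-split {m} {suc n} F m≤1+n with ℕₚ.m≤n⇒m<n∨m≡n m≤1+n
... | inj₂ refl       = sym (trans (cong (_+_ (sumTo (suc n) F)) (Σrange-empty (suc n) F)) (ℕₚ.+-identityʳ _))
... | inj₁ (s≤s m≤n) = begin
  sumTo (suc n) F                  ≡⟨ sumTo-suc n F ⟩
  sumTo n F + F n                  ≡⟨ cong (_+ F n) (sumTo-split F m≤n) ⟩
  sumTo m F + Σrange m n F + F n   ≡⟨ ℕₚ.+-assoc (sumTo m F) _ _ ⟩
  sumTo m F + (Σrange m n F + F n) ≡⟨ cong (_+_ (sumTo m F)) (Σrange-suc m n F m≤n) ⟨
  sumTo m F + Σrange m (suc n) F   ∎
  where open ≡-Reasoning

Σrange-from-0 : ∀ n F → Σrange 0 n F ≡ sumTo n F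
Σrange-from-0 n F = sym (sumTo-split {n = n} F z≤n)

Σrange-head : ∀ {m n} F → m < n → Σrange m n F ≡ F m + Σrange (suc m) n F
Σrange-head {m} {n} F m<n = ℕₚ.+-cancelˡ-≡ (sumTo m F) _ _ (begin
  sumTo m F + Σrange m n F               ≡⟨ sumTo-split F (ℕₚ.<⇒≤ m<n) ⟨
  sumTo n F                              ≡⟨ sumTo-split F m<n ⟩
  sumTo (suc m) F + Σrange (suc m) n F   ≡⟨ cong (_+ Σrange (suc m) n F) (sumTo-suc m F) ⟩
  sumTo m F + F m + Σrange (suc m) n F   ≡⟨ ℕₚ.+-assoc (sumTo m F) _ _ ⟩
  sumTo m F + (F m + Σrange (suc m) n F) ∎)
  where open ≡-Reasoning

ext-toℕ : ∀ {k} (r : Fin k → ℕ) i → ext r (toℕ i) ≡ r i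
ext-toℕ {k} r i with toℕ i <? k
... | yes i<k = cong r (Finₚ.fromℕ<-toℕ i i<k)
... | no  i≮k = ⊥-elim (i≮k (Finₚ.toℕ<n i))

ΣFin-ext : ∀ {k} (r : Fin k → ℕ) → ΣFin r ≡ sumTo k (ext r)
ΣFin-ext {k} r = trans (ΣFin-cong (sym ∘ ext-toℕ r)) (ΣFin-toℕ k (ext r))

piecewise : ℕ → ℕ → (ℕ → ℕ) → (ℕ → ℕ) → ℕ → ℕ
piecewise p c G H j with ℕₚ.<-cmp j p
... | tri< _ _ _ = G j
... | tri≈ _ _ _ = c
... | tri> _ _ _ = H j

module _ (p c : ℕ) (G H : ℕ → ℕ) where

  piecewise-< : ∀ {j} → j < p → piecewise p c G H j ≡ G j
  piecewise-< {j} j<p with ℕₚ.<-cmp j p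
  ... | tri< _ _ _   = refl
  ... | tri≈ j≮p _ _ = ⊥-elim (j≮p j<p)
  ... | tri> j≮p _ _ = ⊥-elim (j≮p j<p)

  piecewise-≡ : piecewise p c G H p ≡ c
  piecewise-≡ with ℕₚ.<-cmp p p
  ... | tri< _ p≢p _ = ⊥-elim (p≢p refl)
  ... | tri≈ _ _ _   = refl
  ... | tri> _ p≢p _ = ⊥-elim (p≢p refl)

  piecewise-> : ∀ {j} → p < j → piecewise p c G H j ≡ H j
  piecewise-> {j} p<j with ℕₚ.<-cmp j p
  ... | tri< _ _ j≯p = ⊥-elim (j≯p p<j)
  ... | tri≈ _ _ j≯p = ⊥-elim (j≯p p<j)
  ... | tri> _ _ _   = refl

  *-piecewise : ∀ j → j * piecewise p c G H j ≡ piecewise p (p * c) (λ j → j * G j) (λ j → j * H j) j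
  *-piecewise j with ℕₚ.<-cmp j p
  ... | tri< _ _ _    = refl
  ... | tri≈ _ refl _ = refl
  ... | tri> _ _ _    = refl

  sumTo-piecewise : ∀ {n} → p < n → sumTo n (piecewise p c G H) ≡ sumTo p G + c + Σrange (suc p) n H
  sumTo-piecewise {n} p<n = begin
    sumTo n P                                    ≡⟨ sumTo-split P p<n ⟩
    sumTo (suc p) P + Σrange (suc p) n P         ≡⟨ cong₂ _+_ (sumTo-suc p P) (Σrange-cong (suc p) n (λ _ → piecewise->)) ⟩
    sumTo p P + P p + Σrange (suc p) n H         ≡⟨ cong (λ x → x + Σrange (suc p) n H)
                                                      (cong₂ _+_ (sumTo-cong p (λ _ → piecewise-<)) piecewise-≡) ⟩
    sumTo p G + c + Σrange (suc p) n H           ∎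
    where
    open ≡-Reasoning
    P : ℕ → ℕ
    P = piecewise p c G H

-- The tuple (r₀, …, r_{I−1}, δ, 0, …, 0); for I = I_r(h) this δ is δ_r(h).
module FrontGreedy {k} (r : Fin k → ℕ) {h I : ℕ} (I<k : I < k)
                   (P≤h : sumTo I (ext r) ≤ h) (h<P′ : h < sumTo (suc I) (ext r)) where

  δ : ℕ
  δ = h ∸ sumTo I (ext r)

  smin : Fin k → ℕ
  smin i = piecewise I δ (ext r) (λ _ → 0) (toℕ i)

  smin-admissible : Admissible r h smin
  smin-admissible = bound , sum
    where
    δ≤r : δ ≤ ext r I
    δ≤r = ℕₚ.m≤n+o⇒m∸n≤o h (sumTo I (ext r)) (ℕₚ.<⇒≤ (subst (h <_) (sumTo-suc I (ext r)) h<P′))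
    bound : smin ≤ᵛ r
    bound i with ℕₚ.<-cmp (toℕ i) I
    ... | tri< _ _ _    = ℕₚ.≤-reflexive (ext-toℕ r i)
    ... | tri≈ _ refl _ = subst (δ ≤_) (ext-toℕ r i) δ≤r
    ... | tri> _ _ _    = z≤n
    sum : ΣFin smin ≡ h
    sum = begin
      ΣFin smin                                             ≡⟨ ΣFin-toℕ k _ ⟩
      sumTo k (piecewise I δ (ext r) (λ _ → 0))             ≡⟨ sumTo-piecewise I δ (ext r) _ I<k ⟩
      sumTo I (ext r) + δ + Σrange (suc I) k (λ _ → 0)      ≡⟨ cong (_+_ (sumTo I (ext r) + δ)) (Σrange-zero (suc I) k) ⟩
      sumTo I (ext r) + δ + 0                               ≡⟨ ℕₚ.+-identityʳ _ ⟩
      sumTo I (ext r) + δ                                   ≡⟨ ℕₚ.m+[n∸m]≡n P≤h ⟩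
      h                                                     ∎
      where open ≡-Reasoning

  weight-smin : weight smin ≡ sumTo I (λ j → j * ext r j) + I * δ
  weight-smin = begin
    weight smin                                                       ≡⟨ ΣFin-toℕ k _ ⟩
    sumTo k (λ j → j * piecewise I δ (ext r) (λ _ → 0) j)             ≡⟨ sumTo-cong k (λ j _ → *-piecewise I δ (ext r) _ j) ⟩
    sumTo k (piecewise I (I * δ) (λ j → j * ext r j) (λ j → j * 0))   ≡⟨ sumTo-piecewise I _ _ _ I<k ⟩
    sumTo I (λ j → j * ext r j) + I * δ + Σrange (suc I) k (λ j → j * 0)
      ≡⟨ cong (_+_ (sumTo I (λ j → j * ext r j) + I * δ))
              (trans (Σrange-cong (suc I) k (λ j _ → ℕₚ.*-zeroʳ j)) (Σrange-zero (suc I) k)) ⟩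
    sumTo I (λ j → j * ext r j) + I * δ + 0                           ≡⟨ ℕₚ.+-identityʳ _ ⟩
    sumTo I (λ j → j * ext r j) + I * δ                               ∎
    where open ≡-Reasoning

  smin-no-shiftDown : ¬ ShiftDown r smin
  smin-no-shiftDown (i , j , i~j , move t s≗ t+eᵢ≤r) = ℕₚ.<-irrefl refl (begin-strict
    r i          ≡⟨ trans (piecewise-< I δ (ext r) _ i<I) (ext-toℕ r i) ⟨
    smin i       ≡⟨ trans (s≗ i) (updateAt-minimal i j t i≢j) ⟩
    t i          <⟨ ℕₚ.n<1+n (t i) ⟩
    suc (t i)    ≡⟨ updateAt-updates i t ⟨
    incAt t i i  ≤⟨ t+eᵢ≤r i ⟩
    r i          ∎)
    where
    open ℕₚ.≤-Reasoning
    i≢j : i ≢ j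
    i≢j = Finₚ.<⇒≢ (Adjacent⇒< i~j)
    j≤I : toℕ j ≤ I
    j≤I = ℕₚ.≮⇒≥ (λ I<j → ℕₚ.0≢1+n (trans (sym (piecewise-> I δ (ext r) _ I<j)) (trans (s≗ j) (updateAt-updates j t))))
    i<I : toℕ i < I
    i<I = ℕₚ.<-≤-trans (Adjacent⇒< i~j) j≤I

-- The tuple (0, …, 0, θ, r_{m+1}, …, r_{k−1}); for m = M_r(h) this θ is θ_r(h).
module BackGreedy {k} (r : Fin k → ℕ) {h m : ℕ} (m<k : m < k)
                  (Q≤h : Σrange (suc m) k (ext r) ≤ h) (h<Q′ : h < Σrange m k (ext r)) where

  θ : ℕ
  θ = h ∸ Σrange (suc m) k (ext r)

  smax : Fin k → ℕ
  smax i = piecewise m θ (λ _ → 0) (ext r) (toℕ i)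

  smax-admissible : Admissible r h smax
  smax-admissible = bound , sum
    where
    θ≤r : θ ≤ ext r m
    θ≤r = ℕₚ.m≤n+o⇒m∸n≤o h (Σrange (suc m) k (ext r))
            (subst (h ≤_) (ℕₚ.+-comm (ext r m) _) (ℕₚ.<⇒≤ (subst (h <_) (Σrange-head (ext r) m<k) h<Q′)))
    bound : smax ≤ᵛ r
    bound i with ℕₚ.<-cmp (toℕ i) m
    ... | tri< _ _ _    = z≤n
    ... | tri≈ _ refl _ = subst (θ ≤_) (ext-toℕ r i) θ≤r
    ... | tri> _ _ _    = ℕₚ.≤-reflexive (ext-toℕ r i)
    sum : ΣFin smax ≡ h
    sum = begin
      ΣFin smax                                                  ≡⟨ ΣFin-toℕ k _ ⟩
      sumTo k (piecewise m θ (λ _ → 0) (ext r))                  ≡⟨ sumTo-piecewise m θ _ (ext r) m<k ⟩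
      sumTo m (λ _ → 0) + θ + Σrange (suc m) k (ext r)           ≡⟨ cong (λ x → x + θ + Σrange (suc m) k (ext r)) (sumTo-zero m) ⟩
      θ + Σrange (suc m) k (ext r)                               ≡⟨ ℕₚ.m∸n+n≡m Q≤h ⟩
      h                                                          ∎
      where open ≡-Reasoning

  weight-smax : weight smax ≡ m * θ + Σrange (suc m) k (λ j → j * ext r j)
  weight-smax = begin
    weight smax                                                       ≡⟨ ΣFin-toℕ k _ ⟩
    sumTo k (λ j → j * piecewise m θ (λ _ → 0) (ext r) j)             ≡⟨ sumTo-cong k (λ j _ → *-piecewise m θ _ (ext r) j) ⟩
    sumTo k (piecewise m (m * θ) (λ j → j * 0) (λ j → j * ext r j))   ≡⟨ sumTo-piecewise m _ _ _ m<k ⟩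
    sumTo m (λ j → j * 0) + m * θ + Σrange (suc m) k (λ j → j * ext r j)
      ≡⟨ cong (λ x → x + m * θ + Σrange (suc m) k (λ j → j * ext r j))
              (trans (sumTo-cong m (λ j _ → ℕₚ.*-zeroʳ j)) (sumTo-zero m)) ⟩
    m * θ + Σrange (suc m) k (λ j → j * ext r j)                      ∎
    where open ≡-Reasoning

  smax-no-shiftUp : ¬ ShiftUp r smax
  smax-no-shiftUp (i , j , i~j , move t s≗ t+eⱼ≤r) = ℕₚ.<-irrefl refl (begin-strict
    r j          ≡⟨ trans (piecewise-> m θ _ (ext r) m<j) (ext-toℕ r j) ⟨
    smax j       ≡⟨ trans (s≗ j) (updateAt-minimal j i t j≢i) ⟩
    t j          <⟨ ℕₚ.n<1+n (t j) ⟩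
    suc (t j)    ≡⟨ updateAt-updates j t ⟨
    incAt t j j  ≤⟨ t+eⱼ≤r j ⟩
    r j          ∎)
    where
    open ℕₚ.≤-Reasoning
    j≢i : j ≢ i
    j≢i = Finₚ.<⇒≢ (Adjacent⇒< i~j) ∘ sym
    m≤i : m ≤ toℕ i
    m≤i = ℕₚ.≮⇒≥ (λ i<m → ℕₚ.0≢1+n (trans (sym (piecewise-< m θ _ (ext r) i<m)) (trans (s≗ i) (updateAt-updates i t))))
    m<j : m < toℕ j
    m<j = ℕₚ.≤-<-trans m≤i (Adjacent⇒< i~j)

largestUpTo-≤ : ∀ (p : ℕ → Bool) n → largestUpTo p n ≤ n
largestUpTo-≤ p zero    = z≤n
largestUpTo-≤ p (suc n) with p (suc n)
... | true  = ℕₚ.≤-refl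
... | false = ℕₚ.m≤n⇒m≤1+n (largestUpTo-≤ p n)

largestUpTo-holds : ∀ (p : ℕ → Bool) n → p 0 ≡ true → p (largestUpTo p n) ≡ true
largestUpTo-holds p zero    p0 = p0
largestUpTo-holds p (suc n) p0 with p (suc n) in p[1+n]
... | true  = p[1+n]
... | false = largestUpTo-holds p n p0

largestUpTo-maximal : ∀ (p : ℕ → Bool) n {m} → largestUpTo p n < m → m ≤ n → p m ≡ false
largestUpTo-maximal p zero    0<m  z≤n = ⊥-elim (ℕₚ.<-irrefl refl 0<m)
largestUpTo-maximal p (suc n) {m} l<m m≤1+n with p (suc n) in p[1+n]
... | true  = ⊥-elim (ℕₚ.<-irrefl refl (ℕₚ.<-≤-trans l<m m≤1+n))
... | false with ℕₚ.m≤n⇒m<n∨m≡n m≤1+n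
...   | inj₂ refl      = p[1+n]
...   | inj₁ (s≤s m≤n) = largestUpTo-maximal p n l<m m≤n

leastUpTo-≤ : ∀ (p : ℕ → Bool) n → leastUpTo p n ≤ n
leastUpTo-≤ p zero    = z≤n
leastUpTo-≤ p (suc n) with p 0
... | true  = z≤n
... | false = s≤s (leastUpTo-≤ (p ∘ suc) n)

leastUpTo-holds : ∀ (p : ℕ → Bool) n → p n ≡ true → p (leastUpTo p n) ≡ true
leastUpTo-holds p zero    pn = pn
leastUpTo-holds p (suc n) pn with p 0 in p0
... | true  = p0
... | false = leastUpTo-holds (p ∘ suc) n pn

leastUpTo-minimal : ∀ (p : ℕ → Bool) n {m} → m < leastUpTo p n → p m ≡ false
leastUpTo-minimal p (suc n) {m} m<l with p 0 in p0
leastUpTo-minimal p (suc n) {zero}  m<l       | false = p0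
leastUpTo-minimal p (suc n) {suc m} (s≤s m<l) | false = leastUpTo-minimal (p ∘ suc) n m<l

does-true : ∀ {A : Set} (d : Dec A) → does d ≡ true → A
does-true (yes a) _ = a
does-true (no _)  ()

does-false : ∀ {A : Set} (d : Dec A) → does d ≡ false → ¬ A
does-false (yes _) ()
does-false (no ¬a) _ = ¬a

≤?-true : ∀ {m n} → does (m ≤? n) ≡ true → m ≤ n
≤?-true = does-true (_ ≤? _)

≤?-false : ∀ {m n} → does (m ≤? n) ≡ false → n < m
≤?-false = ℕₚ.≰⇒> ∘ does-false (_ ≤? _)

module Iᵣ-properties {k} (r : Fin k → ℕ) {h} (h<Σr : h < ΣFin r) where

  private
    I : ℕ
    I = Iᵣ r h
    p : ℕ → Bool
    p n = does (Σrange 0 n (ext r) ≤? h)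

  Iᵣ-prefix≤h : sumTo I (ext r) ≤ h
  Iᵣ-prefix≤h = subst (_≤ h) (Σrange-from-0 I (ext r)) (≤?-true (largestUpTo-holds p k (dec-true (0 ≤? h) z≤n)))

  Iᵣ<k : I < k
  Iᵣ<k with ℕₚ.m≤n⇒m<n∨m≡n (largestUpTo-≤ p k)
  ... | inj₁ I<k = I<k
  ... | inj₂ I≡k = ⊥-elim (ℕₚ.<⇒≱ h<Σr (subst (_≤ h) (trans (cong (λ n → sumTo n (ext r)) I≡k) (sym (ΣFin-ext r))) Iᵣ-prefix≤h))

  h<Iᵣ-prefix : h < sumTo (suc I) (ext r)
  h<Iᵣ-prefix = subst (h <_) (Σrange-from-0 (suc I) (ext r)) (≤?-false (largestUpTo-maximal p k (ℕₚ.n<1+n I) Iᵣ<k))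

module Mᵣ-properties {k} (r : Fin k → ℕ) {h} (h<Σr : h < ΣFin r) where

  private
    p : ℕ → Bool
    p m = does (Σrange m k (ext r) ≤? h)

  suffix≤h : Σrange (Mᵣ+1 r h) k (ext r) ≤ h
  suffix≤h = ≤?-true (leastUpTo-holds p k (dec-true (Σrange k k (ext r) ≤? h) (subst (_≤ h) (sym (Σrange-empty k (ext r))) z≤n)))

  -- Mᵣ+1 r h ≠ 0 as h < ΣFin r, so M_r(h) is the natural number Mᵣℕ.
  Mᵣℕ : ℕ
  Mᵣℕ = pred (Mᵣ+1 r h)

  Mᵣ+1≡ : Mᵣ+1 r h ≡ suc Mᵣℕ
  Mᵣ+1≡ with Mᵣ+1 r h in M+1≡
  ... | suc _ = refl
  ... | zero  = ⊥-elim (ℕₚ.<⇒≱ h<Σr (subst (_≤ h) Σrange0≡Σr (subst (λ m → Σrange m k (ext r) ≤ h) M+1≡ suffix≤h)))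
    where
    Σrange0≡Σr : Σrange 0 k (ext r) ≡ ΣFin r
    Σrange0≡Σr = trans (Σrange-from-0 k (ext r)) (sym (ΣFin-ext r))

  Mᵣℕ<k : Mᵣℕ < k
  Mᵣℕ<k = subst (_≤ k) Mᵣ+1≡ (leastUpTo-≤ p k)

  Mᵣℕ-suffix≤h : Σrange (suc Mᵣℕ) k (ext r) ≤ h
  Mᵣℕ-suffix≤h = subst (λ m → Σrange m k (ext r) ≤ h) Mᵣ+1≡ suffix≤h

  h<Mᵣℕ-suffix : h < Σrange Mᵣℕ k (ext r)
  h<Mᵣℕ-suffix = ≤?-false (leastUpTo-minimal p k (subst (Mᵣℕ <_) (sym Mᵣ+1≡) (ℕₚ.n<1+n Mᵣℕ)))

+-∸ : ∀ {m n} → n ≤ m → + (m ∸ n) ≡ + m ℤ.- + n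
+-∸ {m} {n} n≤m = sym (trans (ℤₚ.m-n≡m⊖n m n) (ℤₚ.⊖-≥ n≤m))

module _ {k} {r : Fin k → ℕ} (pos : Positive r) {h} (h<Σr : h < ΣFin r) where
  open Iᵣ-properties r h<Σr
  open Mᵣ-properties r h<Σr
  open FrontGreedy r Iᵣ<k Iᵣ-prefix≤h h<Iᵣ-prefix
  open BackGreedy r Mᵣℕ<k Mᵣℕ-suffix≤h h<Mᵣℕ-suffix

  L≡weights : L r h ≡ + weight smax ℤ.- + weight smin ℤ.+ + 1
  L≡weights = begin
    L r h
      ≡⟨ cong (λ M → + Σrange M k (λ j → j * ext r j) ℤ.- + B ℤ.+ (+ M ℤ.- + 1) ℤ.* (+ h ℤ.- + Σrange M k (ext r))
                     ℤ.- + I ℤ.* (+ h ℤ.- + P) ℤ.+ + 1) Mᵣ+1≡ ⟩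
    + A ℤ.- + B ℤ.+ (+ suc m ℤ.- + 1) ℤ.* (+ h ℤ.- + Q) ℤ.- + I ℤ.* (+ h ℤ.- + P) ℤ.+ + 1
      ≡⟨ regroup (+ A) (+ B) (+ m) (+ h) (+ Q) (+ I) (+ P) ⟩
    (+ m ℤ.* (+ h ℤ.- + Q) ℤ.+ + A) ℤ.- (+ B ℤ.+ + I ℤ.* (+ h ℤ.- + P)) ℤ.+ + 1
      ≡⟨ cong₂ (λ x y → (+ m ℤ.* x ℤ.+ + A) ℤ.- (+ B ℤ.+ + I ℤ.* y) ℤ.+ + 1) (+-∸ Mᵣℕ-suffix≤h) h-P≡δ ⟨
    (+ m ℤ.* + θ ℤ.+ + A) ℤ.- (+ B ℤ.+ + I ℤ.* + δ) ℤ.+ + 1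
      ≡⟨ cong₂ (λ x y → (x ℤ.+ + A) ℤ.- (+ B ℤ.+ y) ℤ.+ + 1) (ℤₚ.pos-* m θ) (ℤₚ.pos-* I δ) ⟨
    + (m * θ + A) ℤ.- + (B + I * δ) ℤ.+ + 1
      ≡⟨ cong₂ (λ x y → + x ℤ.- + (y + I * δ) ℤ.+ + 1) weight-smax (sym (Σrange-from-0 I _)) ⟨
    + weight smax ℤ.- + (sumTo I (λ j → j * ext r j) + I * δ) ℤ.+ + 1
      ≡⟨ cong (λ y → + weight smax ℤ.- + y ℤ.+ + 1) weight-smin ⟨
    + weight smax ℤ.- + weight smin ℤ.+ + 1
      ∎
    where
    open ≡-Reasoning
    I m A B Q P : ℕ
    I = Iᵣ r h
    m = Mᵣℕ
    A = Σrange (suc m) k (λ j → j * ext r j)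
    B = Σrange 0 I (λ j → j * ext r j)
    Q = Σrange (suc m) k (ext r)
    P = Σrange 0 I (ext r)
    h-P≡δ : + δ ≡ + h ℤ.- + P
    h-P≡δ = trans (+-∸ Iᵣ-prefix≤h) (cong (λ x → + h ℤ.- + x) (sym (Σrange-from-0 I (ext r))))
    -- instantiated at M = + m, where ℤ.+ 1 ℤ.+ + m reduces to + suc m
    regroup : ∀ (A B M H Q I P : ℤ) →
      A ℤ.- B ℤ.+ (ℤ.+ 1 ℤ.+ M ℤ.- ℤ.+ 1) ℤ.* (H ℤ.- Q) ℤ.- I ℤ.* (H ℤ.- P) ℤ.+ ℤ.+ 1
        ≡ (M ℤ.* (H ℤ.- Q) ℤ.+ A) ℤ.- (B ℤ.+ I ℤ.* (H ℤ.- P)) ℤ.+ ℤ.+ 1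
    regroup = ℤ-Solver.solve-∀

  L≡extremal : L r h ≡ + maxWeight k r h ℤ.- + minWeight k r h ℤ.+ + 1
  L≡extremal = trans L≡weights (cong₂ (λ x y → + x ℤ.- + y ℤ.+ + 1) weight-smax≡max weight-smin≡min)
    where
    weight-smax≡max : weight smax ≡ maxWeight k r h
    weight-smax≡max = Sum.[ ⊥-elim ∘ smax-no-shiftUp , id ]′ (shiftUp-or-maxWeight pos smax-admissible)
    weight-smin≡min : weight smin ≡ minWeight k r h
    weight-smin≡min = Sum.[ ⊥-elim ∘ smin-no-shiftDown , id ]′ (shiftDown-or-minWeight pos smin-admissible)

+s≡+x-+y+1⇔s+y≡1+x : ∀ {s x y} → (+ s ≡ + x ℤ.- + y ℤ.+ + 1) ⇔ (s + y ≡ suc x)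
+s≡+x-+y+1⇔s+y≡1+x {s} {x} {y} = mk⇔
  (λ eq → ℤₚ.+-injective (trans (cong (ℤ._+ + y) eq) (sub-add (+ x) (+ y))))
  (λ eq → trans (add-sub (+ s) (+ y)) (trans (cong (λ z → + z ℤ.- + y) eq) (reorder (+ x) (+ y))))
  where
  sub-add : ∀ (X Y : ℤ) → X ℤ.- Y ℤ.+ ℤ.+ 1 ℤ.+ Y ≡ ℤ.+ 1 ℤ.+ X
  sub-add = ℤ-Solver.solve-∀
  add-sub : ∀ (S Y : ℤ) → S ≡ S ℤ.+ Y ℤ.- Y
  add-sub = ℤ-Solver.solve-∀
  reorder : ∀ (X Y : ℤ) → ℤ.+ 1 ℤ.+ X ℤ.- Y ≡ X ℤ.- Y ℤ.+ ℤ.+ 1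
  reorder = ℤ-Solver.solve-∀

theorem2 : (k : ℕ) → 5 ≤ k → (r : Fin k → ℕ) → ((i : Fin k) → 1 ≤ r i) →
    (h : ℕ) → 2 ≤ h → h + 2 ≤ ΣFin r →
    (a : Fin k → ℤ) → StrictlyIncreasing a →
    ((+ restrictedSumsetSize r h a ≡ L r h) ⇔ IsAP a)
theorem2 k 5≤k r pos h 2≤h h+2≤Σr a a↑ = mk⇔
  (λ size≡L → equal-gaps⇒IsAP a 5≤k (Rigidity.gaps-equal pos 2≤h h+2≤Σr a↑ (Equivalence.to extremal⇔ size≡L)))
  (λ AP → Equivalence.from extremal⇔ (ℕₚ.≤-antisym (AP⇒size≤ AP) maxWeight<size+minWeight))
  where
  h<Σr : h < ΣFin r
  h<Σr = ℕₚ.≤-trans (ℕₚ.n≤1+n (suc h)) (subst (_≤ ΣFin r) (ℕₚ.+-comm h 2) h+2≤Σr)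
  open Counting pos (ℕₚ.<⇒≤ h<Σr) a↑
  extremal⇔ : (+ size ≡ L r h) ⇔ (size + minW ≡ suc maxW)
  extremal⇔ = subst (λ l → (+ size ≡ l) ⇔ (size + minW ≡ suc maxW)) (sym (L≡extremal pos h<Σr)) +s≡+x-+y+1⇔s+y≡1+x
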